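{- Let $G=(V,E)$ be a Laman graph, $e=\{v_1,v_2\}\in E$, and $L_{G,e}$ the associated pseudograph. Let $c'$ be the number of connected components of $L_{G,e}$ having more than one vertex, and $k'$ the total number of hanging edges lying in these components. Then $k'\ge 3c'$.
   Context: A Laman graph is a (simple, finite) graph $G=(V,E)$ with $|E|=2|V|-3$ such that every subgraph with vertex set $V'$, $|V'|\ge 2$, and edge set $E'$ satisfies $|E'|\le 2|V'|-3$. A pseudograph $(U,F,H)$ consists of a vertex set $U$, normal edges $F$ each joining two vertices of $U$, and hanging edges $H$ each having a single endpoint in $U$. Given $G$ and $e=\{v_1,v_2\}$, the pseudograph $L_{G,e}=(U,F,H)$ has $U=V\setminus\{v_1,v_2\}$, $F$ = the edges of $E$ having no endpoint in $\{v_1,v_2\}$, and $H$ containing, for each edge of $E$ joining a vertex $u\in U$ to $v_1$ or $v_2$, one hanging edge with endpoint $u$. The connected components of $L_{G,e}$ are the connected components of the graph $(U,F)$, each together with the hanging edges at its vertices. -}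

module Defs where

open import Data.Nat using (ℕ; zero; suc; _+_; _*_; _≤_; _<ᵇ_)
open import Data.Bool using (Bool; true; false; T; if_then_else_; _∧_)
open import Data.Fin using (Fin; zero; suc; toℕ)
open import Data.Fin.Subset using (Subset; _∈_; _∉_; ∣_∣)
open import Data.Vec using (lookup)
open import Data.Product using (_×_; Σ)
open import Data.List using (List; length; map)
open import Data.List.Relation.Unary.Unique.Propositional using (Unique)
import Data.List.Membership.Propositional as LM
open import Relation.Binary.PropositionalEquality using (_≡_; _≢_)
open import Relation.Nullary using (¬_)
open import Function using (_⇔_)

sumFin : ∀ {n} → (Fin n → ℕ) → ℕ
sumFin {zero}  f = 0
sumFin {suc n} f = f zero + sumFin (λ i → f (suc i))

b2n : Bool → ℕ
b2n true  = 1
b2n false = 0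

record Graph (n : ℕ) : Set where
  field
    adj    : Fin n → Fin n → Bool
    sym    : ∀ i j → adj i j ≡ adj j i
    irrefl : ∀ i → adj i i ≡ false
open Graph public

edgeCount : ∀ {n} → (Fin n → Fin n → Bool) → ℕ
edgeCount F = sumFin λ i → sumFin λ j → b2n ((toℕ i <ᵇ toℕ j) ∧ F i j)

IsSubgraph : ∀ {n} → Graph n → Subset n → (Fin n → Fin n → Bool) → Set
IsSubgraph G S F = ∀ i j → T (F i j) → T (adj G i j) × i ∈ S × j ∈ S

IsLaman : ∀ {n} → Graph n → Set
IsLaman {n} G =
  (edgeCount (adj G) + 3 ≡ 2 * n) ×
  (∀ (S : Subset n) (F : Fin n → Fin n → Bool) → IsSubgraph G S F →
     2 ≤ ∣ S ∣ → edgeCount F + 3 ≤ 2 * ∣ S ∣)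

module Pseudo {n : ℕ} (G : Graph n) (v₁ v₂ : Fin n) where

  InU : Fin n → Set
  InU u = (u ≢ v₁) × (u ≢ v₂)

  FEdge : Fin n → Fin n → Set
  FEdge u w = InU u × InU w × T (adj G u w)

  data Reach : Fin n → Fin n → Set where
    here : ∀ {u} → Reach u u
    step : ∀ {u w x} → FEdge u w → Reach w x → Reach u x

  IsComponent : Subset n → Set
  IsComponent C =
    (Σ (Fin n) λ u → u ∈ C) ×
    (∀ u → u ∈ C → InU u) ×
    (∀ u w → u ∈ C → w ∈ C → Reach u w) ×
    (∀ u w → u ∈ C → FEdge u w → w ∈ C)

  hang : Fin n → ℕ
  hang u = b2n (adj G u v₁) + b2n (adj G u v₂)

  hangIn : Subset n → ℕ
  hangIn C = sumFin λ u → if lookup C u then hang u else 0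

  BigComponents : List (Subset n) → Set
  BigComponents Cs =
    Unique Cs × (∀ C → (C LM.∈ Cs) ⇔ (IsComponent C × 2 ≤ ∣ C ∣))

-- Fix a component C of L_{G,e}. Every edge of G lies inside C, inside its
-- complement, or joins the two; since C is closed under the normal edges, an
-- edge leaving C ends in v₁ or v₂, so the joining edges are hanging edges of C.
-- The complement contains v₁ and v₂, hence has at least two vertices, so the
-- Laman count applies to both sides:
--   2|V| − 3 ≤ (2|C| − 3) + (2|V ∖ C| − 3) + k_C,   i.e.   k_C ≥ 3.
-- Summing over the components with more than one vertex gives k′ ≥ 3c′.

module Submission where

open import Defs hiding (sym)
open import Data.Nat using (ℕ; zero; suc; _+_; _*_; _≤_; _<ᵇ_; z≤n; s≤s)
open import Data.Nat.Properties
  using (≤-refl; ≤-reflexive; ≤-trans; m≤m+n; +-mono-≤; +-monoˡ-≤; +-monoʳ-≤;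
         +-cancelˡ-≤; +-cancelʳ-≤;
         +-assoc; +-identityʳ; *-distribˡ-+; *-suc; *-zeroʳ; m+[n∸m]≡n; <ᵇ⇒<; <-asym;
         +-0-commutativeMonoid; module ≤-Reasoning)
open import Data.Nat.Tactic.RingSolver using (solve-∀)
open import Data.Nat.ListAction using (sum)
open import Data.Bool using (Bool; true; false; T; not; _∧_; if_then_else_)
open import Data.Unit using (tt)
open import Data.Empty using (⊥; ⊥-elim)
open import Data.Fin using (Fin; zero; suc; toℕ)
open import Data.Fin.Properties using (_≟_)
open import Data.Fin.Subset using (Subset; ∁; ∣_∣; _∈_)
open import Data.Fin.Subset.Properties using (∣p∣≤n; ∣p∣≤∣x∷p∣; ∣∁p∣≡n∸∣p∣; x∉p⇒x∈∁p)
open import Data.Vec using (_∷_; lookup; here; there)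
open import Data.Vec.Properties using (lookup-map; []=⇒lookup; lookup⇒[]=)
open import Data.List using (List; []; _∷_; length; map)
import Data.List.Membership.Propositional as List
import Data.List.Relation.Unary.Any as Any
open import Data.Product using (_,_; proj₁; proj₂)
open import Function using (_∘_; flip; Equivalence)
open import Relation.Nullary using (yes; no; does)
open import Relation.Binary.PropositionalEquality
  using (_≡_; _≢_; refl; sym; trans; cong; cong₂; subst; module ≡-Reasoning)
open import Algebra.Properties.CommutativeMonoid.Sum +-0-commutativeMonoid
  using (∑-distrib-+; ∑-comm; sum-cong-≗; sum-replicate-zero)
  renaming (sum to ∑)

sumFin≡∑ : ∀ {n} (f : Fin n → ℕ) → sumFin f ≡ ∑ f
sumFin≡∑ {zero}  f = refl
sumFin≡∑ {suc n} f = cong (f zero +_) (sumFin≡∑ (f ∘ suc))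

sumFin-mono : ∀ {n} {f g : Fin n → ℕ} → (∀ i → f i ≤ g i) → sumFin f ≤ sumFin g
sumFin-mono {zero}  f≤g = z≤n
sumFin-mono {suc n} f≤g = +-mono-≤ (f≤g zero) (sumFin-mono (f≤g ∘ suc))

sumFin-zero : ∀ n → sumFin {n} (λ _ → 0) ≡ 0
sumFin-zero n = trans (sumFin≡∑ {n} (λ _ → 0)) (sum-replicate-zero n)

sumFin-distrib-+ : ∀ {n} (f g : Fin n → ℕ) →
                   sumFin (λ i → f i + g i) ≡ sumFin f + sumFin g
sumFin-distrib-+ f g = begin
  sumFin (λ i → f i + g i)  ≡⟨ sumFin≡∑ (λ i → f i + g i) ⟩
  ∑ (λ i → f i + g i)       ≡⟨ ∑-distrib-+ f g ⟩
  ∑ f + ∑ g                 ≡⟨ sym (cong₂ _+_ (sumFin≡∑ f) (sumFin≡∑ g)) ⟩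
  sumFin f + sumFin g       ∎
  where open ≡-Reasoning

sumFin-indicator : ∀ {n} (v : Fin n) (a : ℕ) →
                   sumFin (λ j → if does (j ≟ v) then a else 0) ≡ a
sumFin-indicator {suc n} zero    a = trans (cong (a +_) (sumFin-zero n)) (+-identityʳ a)
sumFin-indicator         (suc v) a = sumFin-indicator v a

sumFin-≤-two-points : ∀ {n} (f : Fin n → ℕ) (v w : Fin n) →
                      (∀ j → j ≢ v → j ≢ w → f j ≡ 0) → sumFin f ≤ f v + f w
sumFin-≤-two-points {n} f v w vanish = begin
  sumFin f                                         ≤⟨ sumFin-mono bound ⟩
  sumFin (λ j → at v (f v) j + at w (f w) j)       ≡⟨ sumFin-distrib-+ (at v (f v)) (at w (f w)) ⟩
  sumFin (at v (f v)) + sumFin (at w (f w))        ≡⟨ cong₂ _+_ (sumFin-indicator v (f v))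
                                                                (sumFin-indicator w (f w)) ⟩
  f v + f w                                        ∎
  where
  open ≤-Reasoning
  at : Fin n → ℕ → Fin n → ℕ
  at u a j = if does (j ≟ u) then a else 0
  bound : ∀ j → f j ≤ at v (f v) j + at w (f w) j
  bound j with j ≟ v | j ≟ w
  ... | yes refl | _        = m≤m+n (f v) _
  ... | no _     | yes refl = ≤-refl
  ... | no j≢v   | no j≢w   = ≤-reflexive (vanish j j≢v j≢w)

Σ² : ∀ {m n} → (Fin m → Fin n → ℕ) → ℕ
Σ² f = sumFin λ i → sumFin λ j → f i j

Σ²≡∑² : ∀ {m n} (f : Fin m → Fin n → ℕ) → Σ² f ≡ ∑ (λ i → ∑ (f i))
Σ²≡∑² f = trans (sumFin≡∑ (λ i → sumFin (f i))) (sum-cong-≗ (λ i → sumFin≡∑ (f i)))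

Σ²-mono : ∀ {m n} {f g : Fin m → Fin n → ℕ} → (∀ i j → f i j ≤ g i j) → Σ² f ≤ Σ² g
Σ²-mono f≤g = sumFin-mono (λ i → sumFin-mono (f≤g i))

Σ²-distrib-+ : ∀ {m n} (f g : Fin m → Fin n → ℕ) →
               Σ² (λ i j → f i j + g i j) ≡ Σ² f + Σ² g
Σ²-distrib-+ f g = begin
  Σ² (λ i j → f i j + g i j)                ≡⟨ Σ²≡∑² (λ i j → f i j + g i j) ⟩
  ∑ (λ i → ∑ (λ j → f i j + g i j))         ≡⟨ sum-cong-≗ (λ i → ∑-distrib-+ (f i) (g i)) ⟩
  ∑ (λ i → ∑ (f i) + ∑ (g i))               ≡⟨ ∑-distrib-+ (λ i → ∑ (f i)) (λ i → ∑ (g i)) ⟩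
  ∑ (λ i → ∑ (f i)) + ∑ (λ i → ∑ (g i))     ≡⟨ sym (cong₂ _+_ (Σ²≡∑² f) (Σ²≡∑² g)) ⟩
  Σ² f + Σ² g                               ∎
  where open ≡-Reasoning

Σ²-transpose : ∀ {m n} (f : Fin m → Fin n → ℕ) → Σ² f ≡ Σ² (flip f)
Σ²-transpose f = trans (Σ²≡∑² f) (trans (∑-comm f) (sym (Σ²≡∑² (flip f))))

b2n-∧-≤ʳ : ∀ a b → b2n (a ∧ b) ≤ b2n b
b2n-∧-≤ʳ false b = z≤n
b2n-∧-≤ʳ true  b = ≤-refl

b2n-∧-split : ∀ l x y a →
  b2n (l ∧ a) ≤ b2n (l ∧ ((x ∧ y) ∧ a)) + b2n (l ∧ ((not x ∧ not y) ∧ a))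
                + (b2n (l ∧ ((x ∧ not y) ∧ a)) + b2n (l ∧ ((y ∧ not x) ∧ a)))
b2n-∧-split false x     y     a     = z≤n
b2n-∧-split true  x     y     false = z≤n
b2n-∧-split true  false false true  = s≤s z≤n
b2n-∧-split true  false true  true  = s≤s z≤n
b2n-∧-split true  true  false true  = s≤s z≤n
b2n-∧-split true  true  true  true  = s≤s z≤n

b2n-∧-disjoint : ∀ l l′ b → (T l → T l′ → ⊥) → b2n (l ∧ b) + b2n (l′ ∧ b) ≤ b2n b
b2n-∧-disjoint false false b     _     = z≤n
b2n-∧-disjoint true  true  b     l∧l′  = ⊥-elim (l∧l′ tt tt)
b2n-∧-disjoint true  false false _     = z≤n
b2n-∧-disjoint true  false true  _     = ≤-refl
b2n-∧-disjoint false true  false _     = z≤n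
b2n-∧-disjoint false true  true  _     = ≤-refl

laman-cut-bound : ∀ {E E₁ E₂ H s t m} → E + 3 ≡ 2 * m → E₁ + 3 ≤ 2 * s → E₂ + 3 ≤ 2 * t →
                  s + t ≡ m → E ≤ E₁ + E₂ + H → 3 ≤ H
laman-cut-bound {E} {E₁} {E₂} {H} {s} {t} {m} edges sparse₁ sparse₂ s+t≡m E≤ =
  +-cancelʳ-≤ 3 3 H (+-cancelˡ-≤ (E₁ + E₂) 6 (H + 3) (begin
    E₁ + E₂ + 6          ≡⟨ regroup E₁ E₂ ⟩
    E₁ + 3 + (E₂ + 3)    ≤⟨ +-mono-≤ sparse₁ sparse₂ ⟩
    2 * s + 2 * t        ≡⟨ sym (*-distribˡ-+ 2 s t) ⟩
    2 * (s + t)          ≡⟨ cong (2 *_) s+t≡m ⟩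
    2 * m                ≡⟨ sym edges ⟩
    E + 3                ≤⟨ +-monoˡ-≤ 3 E≤ ⟩
    E₁ + E₂ + H + 3      ≡⟨ +-assoc (E₁ + E₂) H 3 ⟩
    E₁ + E₂ + (H + 3)    ∎))
  where
  open ≤-Reasoning
  regroup : ∀ a b → a + b + 6 ≡ a + 3 + (b + 3)
  regroup = solve-∀

induced : ∀ {n} → Subset n → (Fin n → Fin n → Bool) → Fin n → Fin n → Bool
induced S F i j = (lookup S i ∧ lookup S j) ∧ F i j

crossing : ∀ {n} → Subset n → (Fin n → Fin n → Bool) → ℕ
crossing S F = Σ² λ i j → b2n ((lookup S i ∧ not (lookup S j)) ∧ F i j)

induced-isSubgraph : ∀ {n} (G : Graph n) (S : Subset n) → IsSubgraph G S (induced S (adj G))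
induced-isSubgraph G S i j ij with lookup S i in Si | lookup S j in Sj
... | true  | true  = ij , lookup⇒[]= i S Si , lookup⇒[]= j S Sj
... | true  | false = ⊥-elim ij
... | false | _     = ⊥-elim ij

edgeCount-≤-induced+crossing :
  ∀ {n} (F : Fin n → Fin n → Bool) → (∀ i j → F i j ≡ F j i) → (S : Subset n) →
  edgeCount F ≤ edgeCount (induced S F) + edgeCount (induced (∁ S) F) + crossing S F
edgeCount-≤-induced+crossing {n} F F-sym S = begin
  edgeCount F
    ≤⟨ Σ²-mono split ⟩
  Σ² (λ i j → inner i j + outer i j + (out i j + into i j))
    ≡⟨ Σ²-distrib-+ (λ i j → inner i j + outer i j) (λ i j → out i j + into i j) ⟩
  Σ² (λ i j → inner i j + outer i j) + Σ² (λ i j → out i j + into i j)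
    ≡⟨ cong₂ _+_ (Σ²-distrib-+ inner outer) (Σ²-distrib-+ out into) ⟩
  edgeCount (induced S F) + edgeCount (induced (∁ S) F) + (Σ² out + Σ² into)
    ≤⟨ +-monoʳ-≤ (edgeCount (induced S F) + edgeCount (induced (∁ S) F)) oriented-cut ⟩
  edgeCount (induced S F) + edgeCount (induced (∁ S) F) + crossing S F
    ∎
  where
  open ≤-Reasoning
  lt : Fin n → Fin n → Bool
  lt i j = toℕ i <ᵇ toℕ j
  inner outer out into : Fin n → Fin n → ℕ
  inner i j = b2n (lt i j ∧ induced S F i j)
  outer i j = b2n (lt i j ∧ induced (∁ S) F i j)
  out   i j = b2n (lt i j ∧ ((lookup S i ∧ not (lookup S j)) ∧ F i j))
  into  i j = b2n (lt i j ∧ ((lookup S j ∧ not (lookup S i)) ∧ F i j))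
  split : ∀ i j → b2n (lt i j ∧ F i j) ≤ inner i j + outer i j + (out i j + into i j)
  split i j rewrite lookup-map i not S | lookup-map j not S =
    b2n-∧-split (lt i j) (lookup S i) (lookup S j) (F i j)
  -- a crossing edge {i, j} with i ∈ S is seen by out i j or by into j i, never both
  cut : ∀ i j → out i j + into j i ≤ b2n ((lookup S i ∧ not (lookup S j)) ∧ F i j)
  cut i j rewrite F-sym j i = b2n-∧-disjoint (lt i j) (lt j i) _ λ i<j j<i →
    <-asym (<ᵇ⇒< (toℕ i) (toℕ j) i<j) (<ᵇ⇒< (toℕ j) (toℕ i) j<i)
  oriented-cut : Σ² out + Σ² into ≤ crossing S F
  oriented-cut = begin
    Σ² out + Σ² into                 ≡⟨ cong (Σ² out +_) (Σ²-transpose into) ⟩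
    Σ² out + Σ² (flip into)          ≡⟨ sym (Σ²-distrib-+ out (flip into)) ⟩
    Σ² (λ i j → out i j + into j i)  ≤⟨ Σ²-mono cut ⟩
    crossing S F                     ∎

x∈p⇒1≤∣p∣ : ∀ {n} {p : Subset n} {x : Fin n} → x ∈ p → 1 ≤ ∣ p ∣
x∈p⇒1≤∣p∣ here                    = s≤s z≤n
x∈p⇒1≤∣p∣ {p = b ∷ p} (there x∈p) = ≤-trans (x∈p⇒1≤∣p∣ x∈p) (∣p∣≤∣x∷p∣ b p)

x∈p∧y∈p∧x≢y⇒2≤∣p∣ : ∀ {n} {p : Subset n} {x y : Fin n} → x ∈ p → y ∈ p → x ≢ y → 2 ≤ ∣ p ∣
x∈p∧y∈p∧x≢y⇒2≤∣p∣ here        here        x≢y = ⊥-elim (x≢y refl)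
x∈p∧y∈p∧x≢y⇒2≤∣p∣ here        (there y∈p) _   = s≤s (x∈p⇒1≤∣p∣ y∈p)
x∈p∧y∈p∧x≢y⇒2≤∣p∣ (there x∈p) here        _   = s≤s (x∈p⇒1≤∣p∣ x∈p)
x∈p∧y∈p∧x≢y⇒2≤∣p∣ {p = b ∷ p} (there x∈p) (there y∈p) x≢y =
  ≤-trans (x∈p∧y∈p∧x≢y⇒2≤∣p∣ x∈p y∈p (x≢y ∘ cong suc)) (∣p∣≤∣x∷p∣ b p)

∣p∣+∣∁p∣≡n : ∀ {n} (p : Subset n) → ∣ p ∣ + ∣ ∁ p ∣ ≡ n
∣p∣+∣∁p∣≡n p = trans (cong (∣ p ∣ +_) (∣∁p∣≡n∸∣p∣ p)) (m+[n∸m]≡n (∣p∣≤n p))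

module _ {n} (G : Graph n) (v₁ v₂ : Fin n) where
  open Pseudo G v₁ v₂

  crossing-≤-hangIn : ∀ {C} → IsComponent C → crossing C (adj G) ≤ hangIn C
  crossing-≤-hangIn {C} (_ , C⊆U , _ , closed) = sumFin-mono row
    where
    row : ∀ i → sumFin (λ j → b2n ((lookup C i ∧ not (lookup C j)) ∧ adj G i j))
              ≤ (if lookup C i then hang i else 0)
    row i with lookup C i in Ci
    ... | false = ≤-reflexive (sumFin-zero n)
    ... | true  = begin
      sumFin f     ≤⟨ sumFin-≤-two-points f v₁ v₂ vanish ⟩
      f v₁ + f v₂  ≤⟨ +-mono-≤ (b2n-∧-≤ʳ (not (lookup C v₁)) (adj G i v₁))
                               (b2n-∧-≤ʳ (not (lookup C v₂)) (adj G i v₂)) ⟩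
      hang i       ∎
      where
      open ≤-Reasoning
      i∈C : i ∈ C
      i∈C = lookup⇒[]= i C Ci
      f : Fin n → ℕ
      f j = b2n (not (lookup C j) ∧ adj G i j)
      vanish : ∀ j → j ≢ v₁ → j ≢ v₂ → f j ≡ 0
      vanish j j≢v₁ j≢v₂ with lookup C j in Cj | adj G i j in ij
      ... | true  | _     = refl
      ... | false | false = refl
      -- otherwise j is an F-neighbour of i ∈ C, so closure puts j in C
      ... | false | true  with () ← trans (sym Cj)
            ([]=⇒lookup (closed i j i∈C (C⊆U i i∈C , (j≢v₁ , j≢v₂) , subst T (sym ij) tt)))

  2≤∣∁C∣ : ∀ {C} → T (adj G v₁ v₂) → IsComponent C → 2 ≤ ∣ ∁ C ∣
  2≤∣∁C∣ {C} v₁v₂ (_ , C⊆U , _) = x∈p∧y∈p∧x≢y⇒2≤∣p∣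
    (x∉p⇒x∈∁p (λ v₁∈C → proj₁ (C⊆U v₁ v₁∈C) refl))
    (x∉p⇒x∈∁p (λ v₂∈C → proj₂ (C⊆U v₂ v₂∈C) refl))
    v₁≢v₂
    where
    v₁≢v₂ : v₁ ≢ v₂
    v₁≢v₂ refl = subst T (irrefl G v₁) v₁v₂

  3≤hangIn : ∀ {C} → IsLaman G → T (adj G v₁ v₂) → IsComponent C → 2 ≤ ∣ C ∣ → 3 ≤ hangIn C
  3≤hangIn {C} (edges , sparse) v₁v₂ C-comp 2≤∣C∣ =
    laman-cut-bound {s = ∣ C ∣} {t = ∣ ∁ C ∣} edges
    (sparse C (induced C (adj G)) (induced-isSubgraph G C) 2≤∣C∣)
    (sparse (∁ C) (induced (∁ C) (adj G)) (induced-isSubgraph G (∁ C)) (2≤∣∁C∣ v₁v₂ C-comp))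
    (∣p∣+∣∁p∣≡n C)
    (≤-trans (edgeCount-≤-induced+crossing (adj G) (Graph.sym G) C)
             (+-monoʳ-≤ _ (crossing-≤-hangIn C-comp)))

*-length≤sum-map : ∀ {a} {A : Set a} (m : ℕ) (f : A → ℕ) (xs : List A) →
                   (∀ x → x List.∈ xs → m ≤ f x) → m * length xs ≤ sum (map f xs)
*-length≤sum-map m f []       _     = ≤-reflexive (*-zeroʳ m)
*-length≤sum-map m f (x ∷ xs) m≤f = begin
  m * suc (length xs)       ≡⟨ *-suc m (length xs) ⟩
  m + m * length xs         ≤⟨ +-mono-≤ (m≤f x (Any.here refl))
                                        (*-length≤sum-map m f xs (λ y → m≤f y ∘ Any.there)) ⟩
  f x + sum (map f xs)      ∎
  where open ≤-Reasoning

lemma1 : ∀ {n} (G : Graph n) → IsLaman G → (v₁ v₂ : Fin n) → T (adj G v₁ v₂) →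
           (Cs : List (Subset n)) → Pseudo.BigComponents G v₁ v₂ Cs →
           3 * length Cs ≤ sum (map (Pseudo.hangIn G v₁ v₂) Cs)
lemma1 G laman v₁ v₂ v₁v₂ Cs (_ , big⇔) =
  *-length≤sum-map 3 (Pseudo.hangIn G v₁ v₂) Cs λ C C∈Cs →
    let (C-comp , 2≤∣C∣) = Equivalence.to (big⇔ C) C∈Cs
    in  3≤hangIn G v₁ v₂ laman v₁v₂ C-comp 2≤∣C∣
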